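{- Both $\mathrm{Inf}$-$2$-$\mathrm{TRP}$ and $\mathrm{Inf}$-$3$-$\mathrm{TRP}$ are undecidable.
   Context: Tiles are color sequences: words of length $6$ listing clockwise the colors at the six edges of a hexagon; an orientation is a cyclic shift. $T_2$ (colors $b,r$) consists of $bbrrrr, rrbbbb, brrbrr, rbbrbb, rbrrrb, brbbbr, bbbbbb, rrrrrr$. $T_3$ (colors $b,r,y$) consists of $yrrbby, ryybbr, yrrybb, ryyrbb, brrbyy, yrbybr, rbyryb, brybyr, brbyyr, bybrry, ryrbby, rbryyb, ybyrrb, yrybbr$. Neighbors in $\mathbb{Z}^2$ differ by one of $d_1=(0,1),d_2=(1,1),d_3=(1,0),d_4=(0,-1),d_5=(-1,-1),d_6=(-1,0)$ (clockwise order). For $k\in\{2,3\}$, an instance of $\mathrm{Inf}$-$k$-$\mathrm{TRP}$ is the encoding of a Turing machine computing a partial function $\mathcal{A}:\mathbb{Z}^2\to T_k$ whose domain may be infinite; the question is whether there exists an assignment to every point $x$ of the domain of an orientation $c_x$ of $\mathcal{A}(x)$ such that $c_x[j]=c_{x+d_j}[j+3\bmod 6]$ whenever $x+d_j$ is also in the domain (colors match on all joint edges of adjacent tiles). -}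

module Defs where

open import Data.Nat using (ℕ; zero; suc; _+_; _*_; _<_)
open import Data.Nat.DivMod using (_mod_)
open import Data.Fin using (Fin; toℕ) renaming (zero to f0; suc to fs)
open import Data.Vec using (Vec; []; _∷_; lookup)
open import Data.Integer using (ℤ; +_; -[1+_]) renaming (_+_ to _+ℤ_)
open import Data.Product using (Σ; _×_; _,_)
open import Relation.Nullary using (¬_)
open import Relation.Binary.PropositionalEquality using (_≡_)

-- Model of computation: Kleene's partial recursive (μ-recursive) functions
-- (Turing-equivalent).  Prog n = program of arity n.

data Prog : ℕ → Set where
  zer  : ∀ {n} → Prog n
  succ : Prog 1
  proj : ∀ {n} → Fin n → Prog n
  comp : ∀ {m n} → Prog m → Vec (Prog n) m → Prog n
  prec : ∀ {n} → Prog n → Prog (suc (suc n)) → Prog (suc n)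
  -- h(0,xs) = f xs ; h(k+1,xs) = g(k, h(k,xs), xs)
  mu   : ∀ {n} → Prog (suc n) → Prog n
  -- least k with f(k,xs) = 0, all f(i,xs) (i<k) defined and nonzero

mutual
  data Eval : ∀ {n} → Prog n → Vec ℕ n → ℕ → Set where
    ev-zer  : ∀ {n} {xs : Vec ℕ n} → Eval zer xs 0
    ev-succ : ∀ {x} → Eval succ (x ∷ []) (suc x)
    ev-proj : ∀ {n} {i : Fin n} {xs} → Eval (proj i) xs (lookup xs i)
    ev-comp : ∀ {m n} {f : Prog m} {gs : Vec (Prog n) m} {xs ys v} →
              EvalVec gs xs ys → Eval f ys v → Eval (comp f gs) xs v
    ev-prec0 : ∀ {n} {f : Prog n} {g} {xs v} →
               Eval f xs v → Eval (prec f g) (0 ∷ xs) v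
    ev-precS : ∀ {n} {f : Prog n} {g} {k xs w v} →
               Eval (prec f g) (k ∷ xs) w → Eval g (k ∷ w ∷ xs) v →
               Eval (prec f g) (suc k ∷ xs) v
    ev-mu   : ∀ {n} {f : Prog (suc n)} {xs k} →
              Eval f (k ∷ xs) 0 →
              (∀ i → i < k → Σ ℕ (λ v → Eval f (i ∷ xs) (suc v))) →
              Eval (mu f) xs k

  data EvalVec : ∀ {m n} → Vec (Prog n) m → Vec ℕ n → Vec ℕ m → Set where
    evv-[] : ∀ {n} {xs : Vec ℕ n} → EvalVec [] xs []
    evv-∷  : ∀ {m n} {g : Prog n} {gs : Vec (Prog n) m} {xs y ys} →
             Eval g xs y → EvalVec gs xs ys → EvalVec (g ∷ gs) xs (y ∷ ys)

tri : ℕ → ℕ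
tri zero    = 0
tri (suc n) = suc n + tri n

⟨_,_⟩ : ℕ → ℕ → ℕ
⟨ a , b ⟩ = tri (a + b) + b

mutual
  code : ∀ {n} → Prog n → ℕ
  code zer        = ⟨ 0 , 0 ⟩
  code succ       = ⟨ 1 , 0 ⟩
  code (proj i)   = ⟨ 2 , toℕ i ⟩
  code (comp f gs) = ⟨ 3 , ⟨ code f , codeVec gs ⟩ ⟩
  code (prec f g) = ⟨ 4 , ⟨ code f , code g ⟩ ⟩
  code (mu f)     = ⟨ 5 , code f ⟩

  codeVec : ∀ {m n} → Vec (Prog n) m → ℕ
  codeVec []       = 0
  codeVec (g ∷ gs) = suc ⟨ code g , codeVec gs ⟩

Decidable₂ : (Prog 2 → Set) → Set
Decidable₂ P = Σ (Prog 1) λ d → ∀ e →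
  (P e → Eval d (code e ∷ []) 1) × (¬ P e → Eval d (code e ∷ []) 0)

Undecidable₂ : (Prog 2 → Set) → Set
Undecidable₂ P = ¬ Decidable₂ P

data Color : Set where
  b r y : Color

Word : Set
Word = Vec Color 6

w : Color → Color → Color → Color → Color → Color → Word
w c0 c1 c2 c3 c4 c5 = c0 ∷ c1 ∷ c2 ∷ c3 ∷ c4 ∷ c5 ∷ []

T₂ : Vec Word 8
T₂ = w b b r r r r ∷ w r r b b b b ∷ w b r r b r r ∷ w r b b r b b ∷
     w r b r r r b ∷ w b r b b b r ∷ w b b b b b b ∷ w r r r r r r ∷ []

T₃ : Vec Word 14
T₃ = w y r r b b y ∷ w r y y b b r ∷ w y r r y b b ∷ w r y y r b b ∷
     w b r r b y y ∷ w y r b y b r ∷ w r b y r y b ∷ w b r y b y r ∷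
     w b r b y y r ∷ w b y b r r y ∷ w r y r b b y ∷ w r b r y y b ∷
     w y b y r r b ∷ w y r y b b r ∷ []

-- orientation: cyclic shift by s
rot : Word → Fin 6 → Fin 6 → Color
rot t s j = lookup t ((toℕ j + toℕ s) mod 6)

opp : Fin 6 → Fin 6
opp j = (toℕ j + 3) mod 6

Point : Set
Point = ℤ × ℤ

-- direction d_{j+1} for word position j (0-indexed), clockwise
dir : Fin 6 → Point
dir f0                          = (+ 0 , + 1)
dir (fs f0)                     = (+ 1 , + 1)
dir (fs (fs f0))                = (+ 1 , + 0)
dir (fs (fs (fs f0)))           = (+ 0 , -[1+ 0 ])
dir (fs (fs (fs (fs f0))))      = (-[1+ 0 ] , -[1+ 0 ])
dir (fs (fs (fs (fs (fs f0))))) = (-[1+ 0 ] , + 0)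

_⊕_ : Point → Point → Point
(a , c) ⊕ (a' , c') = (a +ℤ a' , c +ℤ c')

encℤ : ℤ → ℕ
encℤ (+ n)     = 2 * n
encℤ -[1+ n ] = suc (2 * n)

input : Point → Vec ℕ 2
input (a , c) = encℤ a ∷ encℤ c ∷ []

-- The partial function A : ℤ² → T computed by program e:
-- A(x) = table[t]  iff  e halts on (enc x₁, enc x₂) with output t < N.
Computes : ∀ {N} → Prog 2 → Point → Fin N → Set
Computes e x t = Eval e (input x) (toℕ t)

InfTRP : ∀ {N} → Vec Word N → Prog 2 → Set
InfTRP {N} table e =
  Σ ((x : Point) (t : Fin N) → Computes e x t → Fin 6) λ ρ →
    ∀ (x : Point) (j : Fin 6) (t u : Fin N)
      (p : Computes e x t) (q : Computes e (x ⊕ dir j) u) →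
      rot (lookup table t) (ρ x t p) j
        ≡ rot (lookup table u) (ρ (x ⊕ dir j) u q) (opp j)

module Submission where

-- Both halves follow from one instance of Rice's theorem for the
-- μ-recursive programs of Defs: a set P of binary programs is undecidable
-- as soon as (i) every everywhere-divergent program lies in P and (ii) no
-- extension of one fixed program Bad lies in P.  The proof of Rice's
-- theorem is the usual diagonal argument: from a decider d we build, via
-- a program computing the substitution p ↦ selfApp p on Gödel numbers,
-- a program e that behaves like Bad when d declares e a no-instance and
-- diverges when d declares it a yes-instance.
--
-- For Inf-k-TRP, (i) holds because an empty domain is tiled vacuously,
-- and (ii) holds for Bad the program placing four tiles on the unit
-- rhombus {(0,0),(0,1),(1,1),(1,0)} in an arrangement admitting no
-- matching orientations; this last fact is a finite check, decided by
-- evaluation.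

open import Defs
open import Data.Product using (_×_; _,_; ∃; proj₁; proj₂)
open import Data.Nat using (ℕ; zero; suc; _+_)
open import Data.Nat.Properties using (<-cmp)
open import Data.Fin using (Fin; toℕ; #_) renaming (zero to f0; suc to fs)
open import Data.Fin.Properties using (any?)
open import Data.Vec using (Vec; []; _∷_; lookup)
open import Data.Integer using (+_)
open import Data.Empty using (⊥; ⊥-elim)
open import Relation.Nullary using (¬_; Dec; yes; no)
open import Relation.Nullary.Decidable using (_×-dec_; from-no)
open import Relation.Binary using (tri<; tri≈; tri>)
open import Relation.Binary.PropositionalEquality using (_≡_; refl; subst)

-- Evaluation is deterministic; this is what lets the diagonal program
-- read off the verdict of the decider applied to its own code.
0≢suc : ∀ {n} → 0 ≡ suc n → ⊥
0≢suc ()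

mutual
  eval-det : ∀ {n} {p : Prog n} {xs v v'} → Eval p xs v → Eval p xs v' → v ≡ v'
  eval-det ev-zer ev-zer = refl
  eval-det ev-succ ev-succ = refl
  eval-det ev-proj ev-proj = refl
  eval-det (ev-comp gs f) (ev-comp gs' f') with evalVec-det gs gs'
  ... | refl = eval-det f f'
  eval-det (ev-prec0 f) (ev-prec0 f') = eval-det f f'
  eval-det (ev-precS h g) (ev-precS h' g') with eval-det h h'
  ... | refl = eval-det g g'
  eval-det (ev-mu {k = k} zero-at-k below-k) (ev-mu {k = k'} zero-at-k' below-k')
    with <-cmp k k'
  ... | tri< k<k' _ _ = ⊥-elim (0≢suc (eval-det zero-at-k (proj₂ (below-k' k k<k'))))
  ... | tri≈ _ k≡k' _ = k≡k'
  ... | tri> _ _ k'<k = ⊥-elim (0≢suc (eval-det zero-at-k' (proj₂ (below-k k' k'<k))))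

  evalVec-det : ∀ {m n} {gs : Vec (Prog n) m} {xs ys ys'} →
                EvalVec gs xs ys → EvalVec gs xs ys' → ys ≡ ys'
  evalVec-det evv-[] evv-[] = refl
  evalVec-det (evv-∷ g gs) (evv-∷ g' gs') with eval-det g g' | evalVec-det gs gs'
  ... | refl | refl = refl

num : ∀ {n} → ℕ → Prog n
num zero = zer
num (suc k) = comp succ (num k ∷ [])

ev-num : ∀ {n} {xs : Vec ℕ n} k → Eval (num k) xs k
ev-num zero = ev-zer
ev-num (suc k) = ev-comp (evv-∷ (ev-num k) evv-[]) ev-succ

addP : Prog 2
addP = prec (proj f0) (comp succ (proj (fs f0) ∷ []))

ev-add : ∀ a c → Eval addP (a ∷ c ∷ []) (a + c)
ev-add zero c = ev-prec0 ev-proj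
ev-add (suc a) c = ev-precS (ev-add a c) (ev-comp (evv-∷ ev-proj evv-[]) ev-succ)

triP : Prog 1
triP = prec zer (comp succ (addP ∷ []))

ev-tri : ∀ a → Eval triP (a ∷ []) (tri a)
ev-tri zero = ev-prec0 ev-zer
ev-tri (suc a) = ev-precS (ev-tri a) (ev-comp (evv-∷ (ev-add a (tri a)) evv-[]) ev-succ)

pairP : Prog 2
pairP = comp addP (comp triP (addP ∷ []) ∷ proj (fs f0) ∷ [])

pair : ∀ {n} → Prog n → Prog n → Prog n
pair g h = comp pairP (g ∷ h ∷ [])

ev-pair : ∀ {n} {g h : Prog n} {xs a c} → Eval g xs a → Eval h xs c →
          Eval (pair g h) xs ⟨ a , c ⟩
ev-pair {a = a} {c} eg eh =
  ev-comp (evv-∷ eg (evv-∷ eh evv-[]))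
    (ev-comp (evv-∷ (ev-comp (evv-∷ (ev-add a c) evv-[]) (ev-tri (a + c)))
                    (evv-∷ ev-proj evv-[]))
             (ev-add (tri (a + c)) c))

suc' : ∀ {n} → Prog n → Prog n
suc' g = comp succ (g ∷ [])

ev-suc' : ∀ {n} {g : Prog n} {xs a} → Eval g xs a → Eval (suc' g) xs (suc a)
ev-suc' e = ev-comp (evv-∷ e evv-[]) ev-succ

numCodeP : Prog 1
numCodeP = prec (num (code (num {2} 0)))
  (pair (num 3) (pair (num (code succ)) (suc' (pair (proj (fs f0)) zer))))

ev-numCode : ∀ k → Eval numCodeP (k ∷ []) (code (num {2} k))
ev-numCode zero = ev-prec0 (ev-num _)
ev-numCode (suc k) = ev-precS (ev-numCode k)
  (ev-pair (ev-num 3) (ev-pair (ev-num _) (ev-suc' (ev-pair ev-proj ev-zer))))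

-- Self-application: fix the first argument of p to p's own code.  The
-- program selfAppP performs this substitution on Gödel numbers (an
-- instance of the s-m-n theorem).
selfApp : Prog 3 → Prog 2
selfApp p = comp p (num (code p) ∷ proj f0 ∷ proj (fs f0) ∷ [])

selfAppP : Prog 1
selfAppP =
  pair (num 3) (pair (proj f0) (suc' (pair numCodeP
    (suc' (pair (num (code (proj {2} f0)))
      (suc' (pair (num (code (proj {2} (fs f0)))) zer)))))))

ev-selfApp : ∀ p → Eval selfAppP (code p ∷ []) (code (selfApp p))
ev-selfApp p = ev-pair (ev-num 3) (ev-pair ev-proj (ev-suc' (ev-pair (ev-numCode (code p))
  (ev-suc' (ev-pair (ev-num _) (ev-suc' (ev-pair (ev-num _) ev-zer)))))))

selfApp-intro : ∀ {p A C v} → Eval p (code p ∷ A ∷ C ∷ []) v → Eval (selfApp p) (A ∷ C ∷ []) v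
selfApp-intro {p} run =
  ev-comp (evv-∷ (ev-num (code p)) (evv-∷ ev-proj (evv-∷ ev-proj evv-[]))) run

selfApp-elim : ∀ {p A C v} → Eval (selfApp p) (A ∷ C ∷ []) v → Eval p (code p ∷ A ∷ C ∷ []) v
selfApp-elim {p} (ev-comp (evv-∷ numeral (evv-∷ ev-proj (evv-∷ ev-proj evv-[]))) run) =
  subst (λ z → Eval p (z ∷ _) _) (eval-det numeral (ev-num (code p))) run

isZeroP : Prog 1
isZeroP = prec (num 1) zer

ev-isZero-suc : ∀ m → Eval isZeroP (suc m ∷ []) 0
ev-isZero-suc zero = ev-precS (ev-prec0 (ev-num 1)) ev-zer
ev-isZero-suc (suc m) = ev-precS (ev-isZero-suc m) ev-zer

-- gateP n = least k with isZero n = 0: it converges (to 0) exactly when n ≠ 0.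
gateP : Prog 1
gateP = mu (comp isZeroP (proj (fs f0) ∷ []))

ev-gate : ∀ m → Eval gateP (suc m ∷ []) 0
ev-gate m = ev-mu (ev-comp (evv-∷ ev-proj evv-[]) (ev-isZero-suc m)) (λ _ ())

gate-zero : ∀ {k} → ¬ Eval gateP (0 ∷ []) k
gate-zero (ev-mu zero-at-k _) =
  0≢suc (eval-det zero-at-k (ev-comp (evv-∷ ev-proj evv-[]) (ev-prec0 (ev-num 1))))

-- whenNonzero c f behaves as f where c returns a nonzero value and
-- diverges where c returns 0 (its value is gate + f = 0 + f).  It is
-- opaque: only these two facts are used, and unfolding the Gödel code of
-- a program built with it is needlessly expensive for the type checker.
opaque
  whenNonzero : ∀ {n} → Prog n → Prog n → Prog n
  whenNonzero c f = comp addP (comp gateP (c ∷ []) ∷ f ∷ [])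

  whenNonzero-suc : ∀ {n} {c f : Prog n} {xs m v} →
                    Eval c xs (suc m) → Eval f xs v → Eval (whenNonzero c f) xs v
  whenNonzero-suc {m = m} {v} test run =
    ev-comp (evv-∷ (ev-comp (evv-∷ test evv-[]) (ev-gate m)) (evv-∷ run evv-[])) (ev-add 0 v)

  whenNonzero-zero : ∀ {n} {c f : Prog n} {xs v} →
                     Eval c xs 0 → ¬ Eval (whenNonzero c f) xs v
  whenNonzero-zero test (ev-comp (evv-∷ (ev-comp (evv-∷ test' evv-[]) gate) _) _)
    with eval-det test test'
  ... | refl = gate-zero gate

Extends : Prog 2 → Prog 2 → Set
Extends e f = ∀ xs v → Eval f xs v → Eval e xs v

Diverges : Prog 2 → Set
Diverges e = ∀ xs v → ¬ Eval e xs v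

-- Given a decider d, the program e = selfApp K with
--   K(z, A, C) = Bad(A, C) when d(code (selfApp p)) ≠ 0 for z = code p,
--   divergent otherwise,
-- contradicts d's verdict on e itself.
rice : ∀ {P : Prog 2 → Set} (Bad : Prog 2) →
       (∀ e → Extends e Bad → ¬ P e) → (∀ e → Diverges e → P e) →
       Undecidable₂ P
rice {P} Bad extension-fails divergent-holds (d , decides) = e∉P e∈P
  where
  verdict : Prog 3
  verdict = comp d (comp selfAppP (proj f0 ∷ []) ∷ [])

  K : Prog 3
  K = whenNonzero verdict (comp Bad (proj (fs f0) ∷ proj (fs (fs f0)) ∷ []))

  e : Prog 2
  e = selfApp K

  ev-verdict : ∀ {A C v} → Eval d (code e ∷ []) v → Eval verdict (code K ∷ A ∷ C ∷ []) v
  ev-verdict run = ev-comp (evv-∷ (ev-comp (evv-∷ ev-proj evv-[]) (ev-selfApp K)) evv-[]) run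

  e∉P : ¬ P e
  e∉P e∈P = extension-fails e extends e∈P
    where
    extends : Extends e Bad
    extends (A ∷ C ∷ []) v run = selfApp-intro
      (whenNonzero-suc (ev-verdict (proj₁ (decides e) e∈P))
        (ev-comp (evv-∷ ev-proj (evv-∷ ev-proj evv-[])) run))

  e∈P : P e
  e∈P = divergent-holds e λ { (A ∷ C ∷ []) v run →
    whenNonzero-zero (ev-verdict (proj₂ (decides e) e∉P)) (selfApp-elim run) }

_≟ᶜ_ : (c d : Color) → Dec (c ≡ d)
b ≟ᶜ b = yes refl
b ≟ᶜ r = no λ ()
b ≟ᶜ y = no λ ()
r ≟ᶜ b = no λ ()
r ≟ᶜ r = yes refl
r ≟ᶜ y = no λ ()
y ≟ᶜ b = no λ ()
y ≟ᶜ r = no λ ()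
y ≟ᶜ y = yes refl

Matches : ∀ {N} → Vec Word N → Fin N → Fin 6 → Fin 6 → Fin N → Fin 6 → Set
Matches table t s j u s' = rot (lookup table t) s j ≡ rot (lookup table u) s' (opp j)

-- Matching orientations for tiles t₀ t₁ t₂ t₃ placed at (0,0), (0,1),
-- (1,1), (1,0); the five constraints are the five lattice edges among them.
RhombusTiling : ∀ {N} → Vec Word N → (t₀ t₁ t₂ t₃ : Fin N) → Set
RhombusTiling table t₀ t₁ t₂ t₃ =
  ∃ λ s₀ → ∃ λ s₁ → ∃ λ s₂ → ∃ λ s₃ →
    Matches table t₀ s₀ (# 0) t₁ s₁ × Matches table t₀ s₀ (# 1) t₂ s₂ ×
    Matches table t₁ s₁ (# 2) t₂ s₂ × Matches table t₀ s₀ (# 2) t₃ s₃ ×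
    Matches table t₃ s₃ (# 0) t₂ s₂

rhombus? : ∀ {N} (table : Vec Word N) (t₀ t₁ t₂ t₃ : Fin N) →
           Dec (RhombusTiling table t₀ t₁ t₂ t₃)
rhombus? table t₀ t₁ t₂ t₃ =
  any? λ s₀ → any? λ s₁ → any? λ s₂ → any? λ s₃ →
    matches? t₀ s₀ (# 0) t₁ s₁ ×-dec matches? t₀ s₀ (# 1) t₂ s₂ ×-dec
    matches? t₁ s₁ (# 2) t₂ s₂ ×-dec matches? t₀ s₀ (# 2) t₃ s₃ ×-dec
    matches? t₃ s₃ (# 0) t₂ s₂
  where
  matches? : ∀ t s j u s' → Dec (Matches table t s j u s')
  matches? t s j u s' = rot (lookup table t) s j ≟ᶜ rot (lookup table u) s' (opp j)

divergent-tileable : ∀ {N} (table : Vec Word N) e → Diverges e → InfTRP table e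
divergent-tileable table e diverges =
  (λ x t p → ⊥-elim (diverges _ _ p)) , (λ x j t u p q → ⊥-elim (diverges _ _ p))

-- The four points of the unit rhombus; (0,1), (1,1), (1,0) are the
-- neighbours of the origin in directions d₁, d₂, d₃.
P₀ P₁ P₂ P₃ : Point
P₀ = (+ 0 , + 0)
P₁ = (+ 0 , + 1)
P₂ = (+ 1 , + 1)
P₃ = (+ 1 , + 0)

rhombus-restriction : ∀ {N} (table : Vec Word N) e (t₀ t₁ t₂ t₃ : Fin N) →
  Computes e P₀ t₀ → Computes e P₁ t₁ → Computes e P₂ t₂ → Computes e P₃ t₃ →
  InfTRP table e → RhombusTiling table t₀ t₁ t₂ t₃
rhombus-restriction table e t₀ t₁ t₂ t₃ at₀ at₁ at₂ at₃ (ρ , match) =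
  ρ P₀ t₀ at₀ , ρ P₁ t₁ at₁ , ρ P₂ t₂ at₂ , ρ P₃ t₃ at₃ ,
  match P₀ (# 0) t₀ t₁ at₀ at₁ , match P₀ (# 1) t₀ t₂ at₀ at₂ ,
  match P₁ (# 2) t₁ t₂ at₁ at₂ , match P₀ (# 2) t₀ t₃ at₀ at₃ ,
  match P₃ (# 0) t₃ t₂ at₃ at₂

caseZero : ℕ → ℕ → ℕ → ℕ
caseZero a c zero = a
caseZero a c (suc _) = c

caseZeroP : ℕ → ℕ → Prog 1
caseZeroP a c = prec (num a) (num c)

ev-caseZero : ∀ a c n → Eval (caseZeroP a c) (n ∷ []) (caseZero a c n)
ev-caseZero a c zero = ev-prec0 (ev-num a)
ev-caseZero a c (suc n) = ev-precS (ev-caseZero a c n) (ev-num c)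

-- The total program with values q₀₀, q₀₁, q₁₁, q₁₀ according as each of
-- its arguments is zero or not.  On encoded points, (0,0), (0,1), (1,1),
-- (1,0) fall into the four different cases.
quadrantsP : (q₀₀ q₀₁ q₁₁ q₁₀ : ℕ) → Prog 2
quadrantsP q₀₀ q₀₁ q₁₁ q₁₀ =
  prec (caseZeroP q₀₀ q₀₁) (comp (caseZeroP q₁₀ q₁₁) (proj (fs (fs f0)) ∷ []))

ev-quadrants : ∀ q₀₀ q₀₁ q₁₁ q₁₀ A C →
  Eval (quadrantsP q₀₀ q₀₁ q₁₁ q₁₀) (A ∷ C ∷ []) (caseZero (caseZero q₀₀ q₀₁ C) (caseZero q₁₀ q₁₁ C) A)
ev-quadrants q₀₀ q₀₁ q₁₁ q₁₀ zero C = ev-prec0 (ev-caseZero q₀₀ q₀₁ C)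
ev-quadrants q₀₀ q₀₁ q₁₁ q₁₀ (suc A) C =
  ev-precS (ev-quadrants q₀₀ q₀₁ q₁₁ q₁₀ A C) (ev-comp (evv-∷ ev-proj evv-[]) (ev-caseZero q₁₀ q₁₁ C))

rhombus-obstruction : ∀ {N} (table : Vec Word N) (t₀ t₁ t₂ t₃ : Fin N) →
  ¬ RhombusTiling table t₀ t₁ t₂ t₃ →
  ∀ e → Extends e (quadrantsP (toℕ t₀) (toℕ t₁) (toℕ t₂) (toℕ t₃)) → ¬ InfTRP table e
rhombus-obstruction table t₀ t₁ t₂ t₃ untileable e extends tiling =
  untileable (rhombus-restriction table e t₀ t₁ t₂ t₃
    (extends _ _ (ev-quadrants q₀₀ q₀₁ q₁₁ q₁₀ 0 0))
    (extends _ _ (ev-quadrants q₀₀ q₀₁ q₁₁ q₁₀ 0 2))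
    (extends _ _ (ev-quadrants q₀₀ q₀₁ q₁₁ q₁₀ 2 2))
    (extends _ _ (ev-quadrants q₀₀ q₀₁ q₁₁ q₁₀ 2 0))
    tiling)
  where
  q₀₀ q₀₁ q₁₁ q₁₀ : ℕ
  q₀₀ = toℕ t₀
  q₀₁ = toℕ t₁
  q₁₁ = toℕ t₂
  q₁₀ = toℕ t₃

infTRP-undecidable : ∀ {N} (table : Vec Word N) (t₀ t₁ t₂ t₃ : Fin N) →
  ¬ RhombusTiling table t₀ t₁ t₂ t₃ → Undecidable₂ (InfTRP table)
infTRP-undecidable table t₀ t₁ t₂ t₃ untileable =
  rice (quadrantsP (toℕ t₀) (toℕ t₁) (toℕ t₂) (toℕ t₃))
    (rhombus-obstruction table t₀ t₁ t₂ t₃ untileable)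
    (divergent-tileable table)

-- For T₂ the tiles brrbrr, bbbbbb, bbbbbb, bbrrrr, and for T₃ the tiles
-- yrrbby, yrrybb, ryyrbb, brrbyy, cannot be oriented on the rhombus;
-- both facts are checked by running the decision procedure.
theorem10 : Undecidable₂ (InfTRP T₂) × Undecidable₂ (InfTRP T₃)
theorem10 =
  infTRP-undecidable T₂ (# 2) (# 6) (# 6) (# 0) (from-no (rhombus? T₂ (# 2) (# 6) (# 6) (# 0))) ,
  infTRP-undecidable T₃ (# 0) (# 2) (# 3) (# 4) (from-no (rhombus? T₃ (# 0) (# 2) (# 3) (# 4)))
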